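{- Let $f\colon X\to Y$ be a morphism in $\mathbf{SupOMLatLin}$. Then a (dagger) cokernel of $f$, namely $\ker(f^{*})^{*}$, is the map $Y\to\downarrow f(1)^{\perp}$, $y\mapsto\pi_{f(1)^{\perp}}(y)$ (the Sasaki projection onto $f(1)^{\perp}$ corestricted to $\downarrow f(1)^{\perp}$). Moreover, $f$ is zero-epi iff its cokernel is $0$ iff $f(1)=1$; and $f$ is zero-mono iff the cokernel of $f^{*}$ is $0$ iff $f^{*}(1)=1$.
   Context: An orthomodular lattice is a lattice with $0,1$ and an involutive, order-reversing orthocomplement $x\mapsto x^\perp$ with $x\wedge x^\perp=0$, satisfying $x\le y\Rightarrow y=x\vee(x^\perp\wedge y)$; complete means all joins exist. $x\perp y$ means $x\le y^\perp$. $\mathbf{SupOMLatLin}$ has complete orthomodular lattices as objects and linear maps as morphisms ($f\colon X\to Y$ with $f^{*}\colon Y\to X$ such that $f(x)\perp y$ iff $x\perp f^{*}(y)$), dagger $f\mapsto f^*$, zero object $\{0\}$ and zero morphisms the constant-$0$ maps. It is a dagger kernel category in which the dagger kernel of $g\colon A\to B$ is the inclusion $\downarrow g^{*}(1)^{\perp}\to A$ (with adjoint the Sasaki projection). For $a\in Y$: $\downarrow a=\{u\le a\}$ with orthocomplement $u\mapsto a\wedge u^\perp$, and $\pi_a(y)=a\wedge(a^{\perp}\vee y)$. A morphism $f\colon A\to B$ is zero-epi if for every $g\colon B\to C$, $g\circ f=0$ implies $g=0$; $f$ is zero-mono if $f^{*}$ is zero-epi. -}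

module Defs where

open import Level using (Level) renaming (suc to lsuc; zero to lzero)
open import Data.Product using (Σ; _,_; proj₁; proj₂; _×_)
open import Function.Bundles using (_⇔_; mk⇔)
open import Relation.Binary.PropositionalEquality using (_≡_; refl; subst; sym)

record OMLData : Set₁ where
  infix  4 _≤_
  infixr 7 _∧_
  infixr 6 _∨_
  infix  9 _ᶜ
  field
    Carrier : Set
    _≤_     : Carrier → Carrier → Set
    _∧_     : Carrier → Carrier → Carrier
    _∨_     : Carrier → Carrier → Carrier
    𝟘 𝟙     : Carrier
    _ᶜ      : Carrier → Carrier
    ⋁       : (Carrier → Set) → Carrier

  _⊥_ : Carrier → Carrier → Set
  x ⊥ y = x ≤ y ᶜ

module O = OMLData

record IsCOML (D : OMLData) : Set₁ where
  open OMLData D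
  field
    ≤-refl    : ∀ {x} → x ≤ x
    ≤-trans   : ∀ {x y z} → x ≤ y → y ≤ z → x ≤ z
    ≤-antisym : ∀ {x y} → x ≤ y → y ≤ x → x ≡ y
    ≤-prop    : ∀ {x y} (p q : x ≤ y) → p ≡ q
    ∧-lbˡ : ∀ {x y} → x ∧ y ≤ x
    ∧-lbʳ : ∀ {x y} → x ∧ y ≤ y
    ∧-glb : ∀ {x y z} → z ≤ x → z ≤ y → z ≤ x ∧ y
    ∨-ubˡ : ∀ {x y} → x ≤ x ∨ y
    ∨-ubʳ : ∀ {x y} → y ≤ x ∨ y
    ∨-lub : ∀ {x y z} → x ≤ z → y ≤ z → x ∨ y ≤ z
    𝟘-min : ∀ {x} → 𝟘 ≤ x
    𝟙-max : ∀ {x} → x ≤ 𝟙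
    ⋁-ub  : ∀ (S : Carrier → Set) {x} → S x → x ≤ ⋁ S
    ⋁-lub : ∀ (S : Carrier → Set) {z} → (∀ x → S x → x ≤ z) → ⋁ S ≤ z
    ᶜ-invol : ∀ {x} → x ᶜ ᶜ ≡ x
    ᶜ-anti  : ∀ {x y} → x ≤ y → y ᶜ ≤ x ᶜ
    ᶜ-meet  : ∀ {x} → x ∧ x ᶜ ≡ 𝟘
    orthomodular : ∀ {x y} → x ≤ y → y ≡ x ∨ (x ᶜ ∧ y)

record COML : Set₂ where
  constructor mkCOML
  field
    dat  : OMLData
    laws : IsCOML dat

open COML public

C : COML → Set
C X = O.Carrier (dat X)

IsLinear : (X Y : OMLData) → (O.Carrier X → O.Carrier Y) → (O.Carrier Y → O.Carrier X) → Set
IsLinear X Y f g = ∀ x y → (O._⊥_ Y (f x) y) ⇔ (O._⊥_ X x (g y))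

record Hom (X Y : COML) : Set where
  constructor mkHom
  field
    fun    : C X → C Y
    adj    : C Y → C X
    linear : IsLinear (dat X) (dat Y) fun adj

open Hom public

⊥-sym : (X : COML) → ∀ {x y} → O._⊥_ (dat X) x y → O._⊥_ (dat X) y x
⊥-sym X {x} {y} p = subst (λ z → O._≤_ (dat X) z (O._ᶜ (dat X) x)) (IsCOML.ᶜ-invol (laws X)) (IsCOML.ᶜ-anti (laws X) p)

_† : ∀ {X Y} → Hom X Y → Hom Y X
_† {X} {Y} f = mkHom (adj f) (fun f) lin
  where
  lin : IsLinear (dat Y) (dat X) (adj f) (fun f)
  lin y x = mk⇔ (λ p → ⊥-sym Y (Equivalence.from (linear f x y) (⊥-sym X p)))
                (λ p → ⊥-sym X (Equivalence.to (linear f x y) (⊥-sym Y p)))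
    where open import Function.Bundles using (Equivalence)

IsZero : ∀ {X Y} → Hom X Y → Set
IsZero {X} {Y} f = ∀ x → fun f x ≡ O.𝟘 (dat Y)

CompZero : ∀ {X Y Z} → Hom Y Z → Hom X Y → Set
CompZero {X} {Y} {Z} g f = ∀ x → fun g (fun f x) ≡ O.𝟘 (dat Z)

ZeroEpi : ∀ {X Y} → Hom X Y → Set₂
ZeroEpi {X} {Y} f = ∀ (Z : COML) (g : Hom Y Z) → CompZero g f → IsZero g

ZeroMono : ∀ {X Y} → Hom X Y → Set₂
ZeroMono f = ZeroEpi (f †)

-- dagger kernel  k : K → A  of  g : A → B :
--   g ∘ k = 0,  k* ∘ k = id  (dagger mono), and every h with g ∘ h = 0
--   factors uniquely through k (morphisms compared pointwise)
IsDaggerKernel : ∀ {A B K} → Hom A B → Hom K A → Set₂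
IsDaggerKernel {A} {B} {K} g k =
    CompZero g k
  × (∀ x → adj k (fun k x) ≡ x)
  × (∀ (Z : COML) (h : Hom Z A) → CompZero g h →
       Σ (Hom Z K) λ u →
           (∀ z → fun k (fun u z) ≡ fun h z)
         × (∀ (u' : Hom Z K) → (∀ z → fun k (fun u' z) ≡ fun h z) →
              ∀ z → fun u' z ≡ fun u z))

module _ (Y : COML) (a : C Y) where
  open OMLData (dat Y)
  open IsCOML (laws Y)

  down : OMLData
  down = record
    { Carrier = Σ Carrier (λ u → u ≤ a)
    ; _≤_ = λ u v → proj₁ u ≤ proj₁ v
    ; _∧_ = λ u v → (proj₁ u ∧ proj₁ v) , ≤-trans ∧-lbˡ (proj₂ u)
    ; _∨_ = λ u v → (proj₁ u ∨ proj₁ v) , ∨-lub (proj₂ u) (proj₂ v)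
    ; 𝟘 = 𝟘 , 𝟘-min
    ; 𝟙 = a , ≤-refl
    ; _ᶜ = λ u → (a ∧ proj₁ u ᶜ) , ∧-lbˡ
    ; ⋁ = λ S → ⋁ (λ y → Σ (y ≤ a) λ p → S (y , p))
              , ⋁-lub _ (λ y q → proj₁ q)
    }

  sasaki : Carrier → Carrier
  sasaki y = a ∧ (a ᶜ ∨ y)

  sasaki↓ : Carrier → O.Carrier down
  sasaki↓ y = sasaki y , ∧-lbˡ

  downObj : IsCOML down → COML
  downObj D = mkCOML down D

  incl : (D : IsCOML down) → IsLinear down (dat Y) proj₁ sasaki↓ → Hom (downObj D) Y
  incl D L = mkHom proj₁ sasaki↓ L

-- For a linear map g, g x = 0 iff x ⊥ g*(1), i.e. x ≤ g*(1)^⊥; hence the kernel of g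
-- is the down-set ↓ g*(1)^⊥, whose inclusion has the Sasaki projection as adjoint
-- (orthomodularity makes π_a the identity below a). Applied to f* this gives the
-- cokernel π_{f(1)^⊥}, which vanishes iff f(1)^⊥ = 0; and f is zero-epi iff f(1) = 1,
-- one direction by testing against the cokernel, the other by monotonicity of linear maps.
module Submission where

open import Defs
open import Data.Product using (Σ; _×_; proj₁; proj₂; _,_)
open import Function.Bundles using (_⇔_; mk⇔; Equivalence)
open import Function.Properties.Equivalence using () renaming (sym to ⇔-sym; trans to ⇔-trans)
open import Relation.Binary.PropositionalEquality
  using (_≡_; refl; cong; cong₂; subst; sym; trans; module ≡-Reasoning)

open Equivalence using (to; from)

module Properties (X : COML) where
  open OMLData (dat X) public
  open IsCOML (laws X) public
  open ≡-Reasoning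

  ≡⇒≤ : ∀ {x y} → x ≡ y → x ≤ y
  ≡⇒≤ refl = ≤-refl

  ≤ᶜᶜ : ∀ {x} → x ≤ x ᶜ ᶜ
  ≤ᶜᶜ = ≡⇒≤ (sym ᶜ-invol)

  ᶜ-anti⁻¹ : ∀ {x y} → x ᶜ ≤ y ᶜ → y ≤ x
  ᶜ-anti⁻¹ p = ≤-trans (⊥-sym X p) (≡⇒≤ ᶜ-invol)

  ᶜ-∨ : ∀ {x y} → (x ∨ y) ᶜ ≡ x ᶜ ∧ y ᶜ
  ᶜ-∨ = ≤-antisym (∧-glb (ᶜ-anti ∨-ubˡ) (ᶜ-anti ∨-ubʳ))
                  (⊥-sym X (∨-lub (⊥-sym X ∧-lbˡ) (⊥-sym X ∧-lbʳ)))

  ᶜ-∧ : ∀ {x y} → (x ∧ y) ᶜ ≡ x ᶜ ∨ y ᶜ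
  ᶜ-∧ {x} {y} = begin
    (x ∧ y) ᶜ             ≡⟨ cong _ᶜ (cong₂ _∧_ (sym ᶜ-invol) (sym ᶜ-invol)) ⟩
    (x ᶜ ᶜ ∧ y ᶜ ᶜ) ᶜ     ≡⟨ cong _ᶜ (sym ᶜ-∨) ⟩
    (x ᶜ ∨ y ᶜ) ᶜ ᶜ       ≡⟨ ᶜ-invol ⟩
    x ᶜ ∨ y ᶜ             ∎

  𝟙ᶜ≡𝟘 : 𝟙 ᶜ ≡ 𝟘
  𝟙ᶜ≡𝟘 = ≤-antisym (≤-trans (∧-glb 𝟙-max ≤-refl) (≡⇒≤ ᶜ-meet)) 𝟘-min

  𝟘ᶜ≡𝟙 : 𝟘 ᶜ ≡ 𝟙
  𝟘ᶜ≡𝟙 = trans (cong _ᶜ (sym 𝟙ᶜ≡𝟘)) ᶜ-invol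

  ≡𝟘⇔⊥𝟙 : ∀ {x} → x ≡ 𝟘 ⇔ x ⊥ 𝟙
  ≡𝟘⇔⊥𝟙 = mk⇔ (λ { refl → 𝟘-min }) (λ p → ≤-antisym (≤-trans p (≡⇒≤ 𝟙ᶜ≡𝟘)) 𝟘-min)

  ᶜ≡𝟘⇔≡𝟙 : ∀ {x} → x ᶜ ≡ 𝟘 ⇔ x ≡ 𝟙
  ᶜ≡𝟘⇔≡𝟙 {x} = mk⇔ (λ e → trans (sym ᶜ-invol) (trans (cong _ᶜ e) 𝟘ᶜ≡𝟙))
                    (λ { refl → 𝟙ᶜ≡𝟘 })

  -- Orthomodularity is used exactly here: b^⊥ = a^⊥ ∨ (a ∧ b^⊥) since a^⊥ ≤ b^⊥.
  sasaki-≤ : ∀ {a b} → b ≤ a → sasaki X a b ≡ b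
  sasaki-≤ {a} {b} b≤a = ≤-antisym (ᶜ-anti⁻¹ bᶜ≤) (∧-glb b≤a ∨-ubʳ)
    where
    bᶜ≤ : b ᶜ ≤ (a ∧ (a ᶜ ∨ b)) ᶜ
    bᶜ≤ = ≤-trans (≡⇒≤ (orthomodular (ᶜ-anti b≤a)))
            (∨-lub (ᶜ-anti ∧-lbˡ)
                   (⊥-sym X (≤-trans ∧-lbʳ (∨-lub (⊥-sym X ∧-lbˡ) (⊥-sym X ∧-lbʳ)))))

  sasaki-⊥ : ∀ {a b} → b ≤ a ᶜ → sasaki X a b ≡ 𝟘
  sasaki-⊥ b⊥a = ≤-antisym (≤-trans (∧-glb ∧-lbˡ (≤-trans ∧-lbʳ (∨-lub ≤-refl b⊥a))) (≡⇒≤ ᶜ-meet))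
                           𝟘-min

  sasaki-𝟙 : ∀ {a} → sasaki X a 𝟙 ≡ a
  sasaki-𝟙 = ≤-antisym ∧-lbˡ (∧-glb ≤-refl (≤-trans 𝟙-max ∨-ubʳ))

  ∧-sasakiᶜ : ∀ {a y} → a ∧ (sasaki X a y) ᶜ ≡ a ∧ y ᶜ
  ∧-sasakiᶜ {a} {y} = begin
    a ∧ (a ∧ (a ᶜ ∨ y)) ᶜ       ≡⟨ cong (a ∧_) (trans ᶜ-∧ (cong (a ᶜ ∨_) ᶜ-∨)) ⟩
    a ∧ (a ᶜ ∨ (a ᶜ ᶜ ∧ y ᶜ))   ≡⟨ cong (λ z → a ∧ (a ᶜ ∨ (z ∧ y ᶜ))) ᶜ-invol ⟩
    sasaki X a (a ∧ y ᶜ)        ≡⟨ sasaki-≤ ∧-lbˡ ⟩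
    a ∧ y ᶜ                     ∎

  ↓-≡ : ∀ {a} {u v : O.Carrier (down X a)} → proj₁ u ≡ proj₁ v → u ≡ v
  ↓-≡ {u = u , p} {v = .u , q} refl = cong (u ,_) (≤-prop p q)

  ↓-isCOML : (a : Carrier) → IsCOML (down X a)
  ↓-isCOML a = record
    { ≤-refl       = ≤-refl
    ; ≤-trans      = ≤-trans
    ; ≤-antisym    = λ p q → ↓-≡ (≤-antisym p q)
    ; ≤-prop       = ≤-prop
    ; ∧-lbˡ        = ∧-lbˡ
    ; ∧-lbʳ        = ∧-lbʳ
    ; ∧-glb        = ∧-glb
    ; ∨-ubˡ        = ∨-ubˡ
    ; ∨-ubʳ        = ∨-ubʳ
    ; ∨-lub        = ∨-lub
    ; 𝟘-min        = 𝟘-min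
    ; 𝟙-max        = λ {u} → proj₂ u
    ; ⋁-ub         = λ S {u} s → ⋁-ub _ (proj₂ u , s)
    ; ⋁-lub        = λ S h → ⋁-lub _ (λ y q → h (y , proj₁ q) (proj₂ q))
    ; ᶜ-invol      = λ {u} → ↓-≡ (↓ᶜ-invol (proj₂ u))
    ; ᶜ-anti       = λ p → ∧-glb ∧-lbˡ (≤-trans ∧-lbʳ (ᶜ-anti p))
    ; ᶜ-meet       = ↓-≡ (≤-antisym (≤-trans (∧-glb ∧-lbˡ (≤-trans ∧-lbʳ ∧-lbʳ)) (≡⇒≤ ᶜ-meet)) 𝟘-min)
    ; orthomodular = λ {u} {v} p → ↓-≡ (↓-orthomodular (proj₂ v) p)
    }
    where
    ↓ᶜ-invol : ∀ {u} → u ≤ a → a ∧ (a ∧ u ᶜ) ᶜ ≡ u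
    ↓ᶜ-invol {u} u≤a = begin
      a ∧ (a ∧ u ᶜ) ᶜ       ≡⟨ cong (a ∧_) ᶜ-∧ ⟩
      a ∧ (a ᶜ ∨ u ᶜ ᶜ)     ≡⟨ cong (λ z → a ∧ (a ᶜ ∨ z)) ᶜ-invol ⟩
      sasaki X a u          ≡⟨ sasaki-≤ u≤a ⟩
      u                     ∎
    ↓-orthomodular : ∀ {u v} → v ≤ a → u ≤ v → v ≡ u ∨ ((a ∧ u ᶜ) ∧ v)
    ↓-orthomodular {u} {v} v≤a u≤v = trans (orthomodular u≤v) (cong (u ∨_) uᶜ∧v≡)
      where
      uᶜ∧v≡ : u ᶜ ∧ v ≡ (a ∧ u ᶜ) ∧ v
      uᶜ∧v≡ = ≤-antisym (∧-glb (∧-glb (≤-trans ∧-lbʳ v≤a) ∧-lbˡ) ∧-lbʳ)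
                        (∧-glb (≤-trans ∧-lbˡ ∧-lbʳ) ∧-lbʳ)

  sasaki-linear : (a : Carrier) → IsLinear (down X a) (dat X) proj₁ (sasaki↓ X a)
  sasaki-linear a (u , u≤a) y =
    mk⇔ (λ u⊥y → subst (u ≤_) (sym ∧-sasakiᶜ) (∧-glb u≤a u⊥y))
        (λ u⊥πy → ≤-trans (subst (u ≤_) ∧-sasakiᶜ u⊥πy) ∧-lbʳ)

  ↓_ : Carrier → COML
  ↓ a = downObj X a (↓-isCOML a)

  ι : (a : Carrier) → Hom (↓ a) X
  ι a = incl X a (↓-isCOML a) (sasaki-linear a)

  ι†-isZero⇔≡𝟘 : ∀ {a} → IsZero (ι a †) ⇔ a ≡ 𝟘
  ι†-isZero⇔≡𝟘 = mk⇔ (λ π≡𝟘 → trans (sym sasaki-𝟙) (cong proj₁ (π≡𝟘 𝟙)))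
                      (λ { refl y → ↓-≡ (≤-antisym ∧-lbˡ 𝟘-min) })

module _ {X Y : COML} (f : Hom X Y) where
  private
    module X = Properties X
    module Y = Properties Y

  fun-mono : ∀ {x x'} → x X.≤ x' → fun f x Y.≤ fun f x'
  fun-mono {x} {x'} x≤x' =
    Y.≤-trans (from (linear f x _) (X.≤-trans x≤x' (to (linear f x' _) Y.≤ᶜᶜ)))
              (Y.≡⇒≤ Y.ᶜ-invol)

  fun≡𝟘⇔≤adjᶜ : ∀ {x} → fun f x ≡ Y.𝟘 ⇔ x X.≤ adj f Y.𝟙 X.ᶜ
  fun≡𝟘⇔≤adjᶜ {x} = ⇔-trans Y.≡𝟘⇔⊥𝟙 (linear f x Y.𝟙)

corestrict : ∀ {Z A} (h : Hom Z A) (a : C A) → (∀ z → O._≤_ (dat A) (fun h z) a) →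
             Hom Z (Properties.↓_ A a)
corestrict {Z} {A} h a h≤a =
  mkHom (λ z → fun h z , h≤a z) (λ v → adj h (proj₁ v)) λ z v →
    mk⇔ (λ hz⊥v → to (linear h z (proj₁ v)) (A.≤-trans hz⊥v A.∧-lbʳ))
        (λ z⊥h*v → A.∧-glb (h≤a z) (from (linear h z (proj₁ v)) z⊥h*v))
  where module A = Properties A

ι-isDaggerKernel : ∀ {A B} (g : Hom A B) →
                   IsDaggerKernel g (Properties.ι A (O._ᶜ (dat A) (adj g (O.𝟙 (dat B)))))
ι-isDaggerKernel {A} {B} g =
    (λ u → from (fun≡𝟘⇔≤adjᶜ g) (proj₂ u))
  , (λ u → A.↓-≡ (A.sasaki-≤ (proj₂ u)))
  , λ Z h gh≡𝟘 →
      corestrict h a (λ z → to (fun≡𝟘⇔≤adjᶜ g) (gh≡𝟘 z))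
    , (λ z → refl)
    , λ _ ιu'≡h z → A.↓-≡ (ιu'≡h z)
  where
  module A = Properties A
  a = adj g (O.𝟙 (dat B)) A.ᶜ

-- The cokernel ι† itself is the test map: ι† ∘ f = 0 because f x ≤ f 1 = a^⊥.
zeroEpi⇔fun𝟙≡𝟙 : ∀ {X Y} (f : Hom X Y) → ZeroEpi f ⇔ fun f (O.𝟙 (dat X)) ≡ O.𝟙 (dat Y)
zeroEpi⇔fun𝟙≡𝟙 {X} {Y} f = mk⇔ fun𝟙≡𝟙 zeroEpi
  where
  module X = Properties X
  module Y = Properties Y
  a = fun f X.𝟙 Y.ᶜ
  fun𝟙≡𝟙 : ZeroEpi f → fun f X.𝟙 ≡ Y.𝟙
  fun𝟙≡𝟙 ze = to Y.ᶜ≡𝟘⇔≡𝟙 (to Y.ι†-isZero⇔≡𝟘 (ze (Y.↓ a) (Y.ι a †) π∘f≡𝟘))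
    where
    π∘f≡𝟘 : CompZero (Y.ι a †) f
    π∘f≡𝟘 x = Y.↓-≡ (Y.sasaki-⊥ (Y.≤-trans (fun-mono f X.𝟙-max) Y.≤ᶜᶜ))
  zeroEpi : fun f X.𝟙 ≡ Y.𝟙 → ZeroEpi f
  zeroEpi f𝟙≡𝟙 Z g g∘f≡𝟘 y = Z.≤-antisym
    (Z.≤-trans (fun-mono g Y.𝟙-max) (Z.≡⇒≤ (subst (λ w → fun g w ≡ Z.𝟘) f𝟙≡𝟙 (g∘f≡𝟘 X.𝟙))))
    Z.𝟘-min
    where module Z = Properties Z

sasaki-cokernel : (X Y : COML) (f : Hom X Y) →
    let a = OMLData._ᶜ (dat Y) (fun f (OMLData.𝟙 (dat X))) in
    Σ (IsCOML (down Y a)) λ D →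
    Σ (IsLinear (down Y a) (dat Y) proj₁ (sasaki↓ Y a)) λ L →
        IsDaggerKernel (f †) (incl Y a D L)
      × (ZeroEpi f ⇔ IsZero (incl Y a D L †))
      × (IsZero (incl Y a D L †) ⇔ (fun f (OMLData.𝟙 (dat X)) ≡ OMLData.𝟙 (dat Y)))
sasaki-cokernel X Y f =
  Y.↓-isCOML a , Y.sasaki-linear a , ι-isDaggerKernel (f †) ,
  ⇔-trans (zeroEpi⇔fun𝟙≡𝟙 f) (⇔-sym ι†-isZero⇔f𝟙≡𝟙) , ι†-isZero⇔f𝟙≡𝟙
  where
  module Y = Properties Y
  a = fun f (O.𝟙 (dat X)) Y.ᶜ
  ι†-isZero⇔f𝟙≡𝟙 : IsZero (Y.ι a †) ⇔ fun f (O.𝟙 (dat X)) ≡ Y.𝟙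
  ι†-isZero⇔f𝟙≡𝟙 = ⇔-trans Y.ι†-isZero⇔≡𝟘 Y.ᶜ≡𝟘⇔≡𝟙

lemma13 : (X Y : COML) (f : Hom X Y) →
    let a  = OMLData._ᶜ (dat Y) (fun f (OMLData.𝟙 (dat X)))
        a' = OMLData._ᶜ (dat X) (adj f (OMLData.𝟙 (dat Y)))
    in
    (Σ (IsCOML (down Y a)) λ D →
     Σ (IsLinear (down Y a) (dat Y) proj₁ (sasaki↓ Y a)) λ L →
         IsDaggerKernel (f †) (incl Y a D L)
       × (ZeroEpi f ⇔ IsZero (incl Y a D L †))
       × (IsZero (incl Y a D L †) ⇔ (fun f (OMLData.𝟙 (dat X)) ≡ OMLData.𝟙 (dat Y))))
    ×
    (Σ (IsCOML (down X a')) λ D' →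
     Σ (IsLinear (down X a') (dat X) proj₁ (sasaki↓ X a')) λ L' →
         IsDaggerKernel f (incl X a' D' L')
       × (ZeroMono f ⇔ IsZero (incl X a' D' L' †))
       × (IsZero (incl X a' D' L' †) ⇔ (adj f (OMLData.𝟙 (dat Y)) ≡ OMLData.𝟙 (dat X))))
lemma13 X Y f = sasaki-cokernel X Y f , sasaki-cokernel Y X (f †)
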